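{- Let $G=(V,E)$ be a graph, let $\{u_1,u_2\}$ be a permissible edge of $G$, and let $G'=(V',E')$ be obtained from $G$ by attaching a permissible cycle $v_1,\dots,v_k$ to $\{u_1,u_2\}$. Then $G'$ is Hamiltonian if and only if $G$ is Hamiltonian. Moreover, the edges $\{v_i,v_{i+1}\}$ for $1\le i<k$ are all permissible in $G'$.
   Context: An edge $e$ of a graph $H$ is permissible if $H$ is not Hamiltonian or $H$ contains a Hamiltonian cycle passing through $e$. For a permissible edge $\{u_1,u_2\}$ of $G=(V,E)$, $G'=(V',E')$ is obtained by attaching a permissible cycle to $\{u_1,u_2\}$ if: $V'=V\uplus\{v_1,\dots,v_k\}$ with $k\ge4$, and $v_1,\dots,v_k$ induce a cycle in this order, i.e. $\{v_i,v_j\}\in E'$ iff $|i-j|=1$ or $\{i,j\}=\{1,k\}$; $E'\cap\binom{V}{2}=E$; for every $i\in\{2,\dots,k-1\}$, if $\deg_{G'}(v_i)\ge3$ then $\deg_{G'}(v_{i-1})=\deg_{G'}(v_{i+1})=2$; and $\deg_{G'}(v_1)=\deg_{G'}(v_k)=3$ with $\{\{v_1,u_1\},\{v_k,u_2\}\}\subseteq E'$. -}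

module Defs where

open import Data.Nat using (ℕ; zero; suc; _+_; _≤_; _∸_)
open import Data.Nat.DivMod using (_mod_)
open import Data.Fin using (Fin; toℕ; _↑ˡ_; _↑ʳ_)
open import Data.Bool using (Bool; true; false)
open import Data.List using (List; length; filterᵇ)
open import Data.List using () renaming (allFin to allFinL)
open import Data.Product using (Σ; ∃; _×_; _,_)
open import Data.Sum using (_⊎_)
open import Relation.Nullary using (¬_)
open import Relation.Binary.PropositionalEquality using (_≡_)
open import Function.Definitions using (Bijective)
open import Function.Bundles using (_⇔_)

record Graph (n : ℕ) : Set where
  field
    E      : Fin n → Fin n → Bool
    sym    : ∀ x y → E x y ≡ E y x
    irrefl : ∀ x → E x x ≡ false
open Graph public

Adj : ∀ {n} → Graph n → Fin n → Fin n → Set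
Adj G x y = E G x y ≡ true

deg : ∀ {n} → Graph n → Fin n → ℕ
deg {n} G x = length (filterᵇ (E G x) (allFinL n))

next : ∀ {n} → Fin n → Fin n
next {suc m} i = suc (toℕ i) mod suc m

record HamCycle {n} (G : Graph n) : Set where
  field
    σ     : Fin n → Fin n
    bij   : Bijective _≡_ _≡_ σ
    adj   : ∀ i → Adj G (σ i) (σ (next i))
open HamCycle public

Hamiltonian : ∀ {n} → Graph n → Set
Hamiltonian G = HamCycle G

PassesThrough : ∀ {n} {G : Graph n} → HamCycle G → Fin n → Fin n → Set
PassesThrough C a b =
  ∃ λ i → (σ C i ≡ a × σ C (next i) ≡ b) ⊎ (σ C i ≡ b × σ C (next i) ≡ a)

Permissible : ∀ {n} → Graph n → Fin n → Fin n → Set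
Permissible G a b =
  Adj G a b × (¬ Hamiltonian G ⊎ Σ (HamCycle G) λ C → PassesThrough C a b)

-- Old vertex x ∈ V is
-- inject+ k x; the new vertex v_{i+1} (i : Fin k, 0-indexed) is n ↑ʳ i.
record AttachCycle {n} (G : Graph n) (u₁ u₂ : Fin n) (k : ℕ) (G' : Graph (n + k)) : Set where
  private
    old : Fin n → Fin (n + k)
    old x = x ↑ˡ k
    v : Fin k → Fin (n + k)
    v i = n ↑ʳ i
  field
    k≥4      : 4 ≤ k
    cycle    : ∀ i j → (Adj G' (v i) (v j) ⇔ (j ≡ next i ⊎ i ≡ next j))
    restrict : ∀ x y → E G' (old x) (old y) ≡ E G x y
    sparse   : ∀ i j l → toℕ j ≡ suc (toℕ i) → toℕ l ≡ suc (toℕ j) →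
               3 ≤ deg G' (v j) → deg G' (v i) ≡ 2 × deg G' (v l) ≡ 2
    deg-first : ∀ i → toℕ i ≡ 0 → deg G' (v i) ≡ 3
    deg-last  : ∀ i → toℕ i ≡ k ∸ 1 → deg G' (v i) ≡ 3
    edge-first : ∀ i → toℕ i ≡ 0 → Adj G' (v i) (old u₁)
    edge-last  : ∀ i → toℕ i ≡ k ∸ 1 → Adj G' (v i) (old u₂)

{-# OPTIONS --safe #-}
-- A Hamiltonian cycle is handled through its successor function on vertices. In G′ every edge
-- v_j v_{j+1} of the attached cycle has an inner endpoint of degree 2 (this is what the degree
-- condition on the v_j guarantees), and both edges at a vertex of degree 2 lie on every
-- Hamiltonian cycle; hence a Hamiltonian cycle of G′ runs through v_1, …, v_k consecutively.
-- After rotating, and possibly reversing, it lists the old vertices at positions 0, …, n-1 and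
-- v_1, …, v_k at positions n, …, n+k-1. The ends v_1, v_k have degree 3, which forces the old
-- vertices next to them to be u₁ and u₂, so dropping the detour v_1 … v_k and closing up with the
-- edge u₁u₂ gives a Hamiltonian cycle of G. Conversely, permissibility provides a Hamiltonian
-- cycle of G through u₁u₂ as soon as G is Hamiltonian; cutting it open at that edge and inserting
-- the path v_1 … v_k gives a Hamiltonian cycle of G′ that uses every edge v_i v_{i+1}. If G is not
-- Hamiltonian, neither is G′, and those edges are permissible vacuously.
module Submission where

open import Defs hiding (sym)
open import Data.Bool using (T)
open import Data.Empty using (⊥-elim)
open import Data.Fin using (Fin; zero; suc; toℕ; opposite; _↑ˡ_; _↑ʳ_; splitAt; join)
open import Data.Fin.Properties
  using (toℕ-injective; toℕ<n; toℕ-fromℕ<; opposite-prop; opposite-involutive; toℕ-↑ˡ; toℕ-↑ʳ; ↑ˡ-injective; ↑ʳ-injective; splitAt⁻¹-↑ˡ; splitAt⁻¹-↑ʳ; splitAt-↑ˡ; splitAt-↑ʳ; injective⇒≤; any?; _≟_)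
open import Data.List.Membership.Propositional.Properties using (∈-filter⁺; ∈-allFin)
open import Data.List.Membership.Setoid.Properties using (index-injective)
open import Data.List.Relation.Unary.Any using (index)
open import Data.Nat using (ℕ; zero; suc; _+_; _∸_; _≤_; _<_; z≤n; s≤s; s≤s⁻¹; _≤?_; _<?_)
open import Data.Nat.DivMod using (_mod_; _%_; m<n⇒m%n≡m; n%n≡0; m%n%n≡m%n; %-distribˡ-+; [m+n]%n≡m%n)
open import Data.Nat.GeneralisedArithmetic using (fold; fold-+)
open import Data.Nat.Properties
  using (+-assoc; +-cancelˡ-≡; +-comm; +-identityʳ; +-suc; +-∸-assoc; 1+n≰n; <-trans; <-≤-trans; <⇒≢; <⇒≱; m<m+n; m≢1+n+m; m≤m+n; m≤n+m; m≤n⇒m<n∨m≡n; n<1+n; n∸n≡0; n≤1+n; suc-injective; ≤-antisym; ≤-refl; ≤-reflexive; ≤-trans; ≮⇒≥; ≰⇒>)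
open import Data.Product using (Σ; ∃; _×_; _,_; proj₁; proj₂; uncurry)
open import Data.Sum using (_⊎_; inj₁; inj₂; [_,_]′; map₁; swap)
open import Data.Vec.Functional using (_∷_; [])
open import Function using (_∘_)
open import Function.Bundles using (Equivalence; _⇔_; mk⇔)
open import Function.Consequences.Propositional
  using (inverseᵇ⇒bijective; strictlySurjective⇒surjective; strictlyInverseˡ⇒inverseˡ; strictlyInverseʳ⇒inverseʳ)
import Function.Construct.Composition as Comp
import Function.Construct.Identity as Ident
open import Function.Definitions using (Bijective; Injective; StrictlySurjective)
open import Relation.Nullary using (¬_; yes; no)
open import Relation.Nullary.Decidable using (T?)
open import Relation.Binary.PropositionalEquality

Adj-sym : ∀ {N} (G : Graph N) {x y} → Adj G x y → Adj G y x
Adj-sym G {x} {y} x~y = trans (Graph.sym G y x) x~y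

Consecutive : ∀ {N} → Fin N → Fin N → Set
Consecutive i j = toℕ j ≡ suc (toℕ i)

IsLast : ∀ {N} → Fin N → Set
IsLast {N} i = suc (toℕ i) ≡ N

-- The cyclic order of Fin (suc m)

fold-suc : ∀ {A : Set} (s : A → A) (z : A) r → fold (s z) s r ≡ s (fold z s r)
fold-suc s z r = trans (sym (fold-+ z s r {1})) (cong (fold z s) (+-comm r 1))

fold-bijective : ∀ {A : Set} {s : A → A} → Bijective _≡_ _≡_ s →
                 ∀ r → Bijective _≡_ _≡_ (λ z → fold z s r)
fold-bijective s-bij zero    = Ident.bijective _≡_
fold-bijective s-bij (suc r) = Comp.bijective _≡_ _≡_ _≡_ (fold-bijective s-bij r) s-bij

opposite-bijective : ∀ {N} → Bijective _≡_ _≡_ (opposite {N})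
opposite-bijective = inverseᵇ⇒bijective
  ( strictlyInverseˡ⇒inverseˡ opposite opposite-involutive
  , strictlyInverseʳ⇒inverseʳ opposite opposite-involutive)

module _ {m : ℕ} where

  private
    N : ℕ
    N = suc m

  toℕ-mod : ∀ {t} → t < N → toℕ (t mod N) ≡ t
  toℕ-mod t<N = trans (toℕ-fromℕ< _) (m<n⇒m%n≡m t<N)

  mod-toℕ : ∀ (i : Fin N) → toℕ i mod N ≡ i
  mod-toℕ i = toℕ-injective (toℕ-mod (toℕ<n i))

  next-mod : ∀ t → next (t mod N) ≡ suc t mod N
  next-mod t = toℕ-injective (begin
    toℕ (next (t mod N))        ≡⟨ toℕ-fromℕ< _ ⟩
    suc (toℕ (t mod N)) % N     ≡⟨ cong (λ x → suc x % N) (toℕ-fromℕ< _) ⟩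
    (1 + t % N) % N             ≡⟨ %-distribˡ-+ 1 (t % N) N ⟩
    (1 % N + t % N % N) % N     ≡⟨ cong (λ x → (1 % N + x) % N) (m%n%n≡m%n t N) ⟩
    (1 % N + t % N) % N         ≡⟨ %-distribˡ-+ 1 t N ⟨
    suc t % N                   ≡⟨ toℕ-fromℕ< _ ⟨
    toℕ (suc t mod N)           ∎)
    where open ≡-Reasoning

  fold-next : ∀ (i : Fin N) t → fold i next t ≡ (t + toℕ i) mod N
  fold-next i zero    = sym (mod-toℕ i)
  fold-next i (suc t) = trans (cong next (fold-next i t)) (next-mod (t + toℕ i))

  fold-next-comm : ∀ (i j : Fin N) → fold i next (toℕ j) ≡ fold j next (toℕ i)
  fold-next-comm i j =
    trans (fold-next i (toℕ j)) (trans (cong (_mod N) (+-comm (toℕ j) (toℕ i))) (sym (fold-next j (toℕ i))))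

  fold-next-period : ∀ (i : Fin N) → fold i next N ≡ i
  fold-next-period i = toℕ-injective (begin
    toℕ (fold i next N)        ≡⟨ cong toℕ (fold-next i N) ⟩
    toℕ ((N + toℕ i) mod N)    ≡⟨ toℕ-fromℕ< _ ⟩
    (N + toℕ i) % N            ≡⟨ cong (_% N) (+-comm N (toℕ i)) ⟩
    (toℕ i + N) % N            ≡⟨ [m+n]%n≡m%n (toℕ i) N ⟩
    toℕ i % N                  ≡⟨ m<n⇒m%n≡m (toℕ<n i) ⟩
    toℕ i                      ∎)
    where open ≡-Reasoning

  next-bijective : Bijective _≡_ _≡_ (next {N})
  next-bijective = inverseᵇ⇒bijective
    ( strictlyInverseˡ⇒inverseˡ next fold-next-period
    , strictlyInverseʳ⇒inverseʳ next (λ i → trans (fold-suc next i m) (fold-next-period i)))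

  next-consecutive : ∀ {i j : Fin N} → Consecutive i j → next i ≡ j
  next-consecutive {i} {j} i⋖j = toℕ-injective
    (trans (toℕ-fromℕ< _) (trans (cong (_% N) (sym i⋖j)) (m<n⇒m%n≡m (toℕ<n j))))

  next-last : ∀ {i j : Fin N} → IsLast i → toℕ j ≡ 0 → next i ≡ j
  next-last {i} {j} last j≡0 = toℕ-injective
    (trans (toℕ-fromℕ< _) (trans (cong (_% N) last) (trans (n%n≡0 N) (sym j≡0))))

  next-cases : ∀ (i : Fin N) → Consecutive i (next i) ⊎ (IsLast i × toℕ (next i) ≡ 0)
  next-cases i with m≤n⇒m<n∨m≡n (toℕ<n i)
  ... | inj₁ i+1<N = inj₁ (trans (toℕ-fromℕ< _) (m<n⇒m%n≡m i+1<N))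
  ... | inj₂ last  = inj₂ (last , trans (toℕ-fromℕ< _) (trans (cong (_% N) last) (n%n≡0 N)))

  next-opposite : ∀ (i : Fin N) → next (opposite (next i)) ≡ opposite i
  next-opposite i with next-cases i
  ... | inj₁ i⋖i+1 = next-consecutive (begin
    toℕ (opposite i)              ≡⟨ opposite-prop i ⟩
    N ∸ suc (toℕ i)               ≡⟨ +-∸-assoc 1 i+1≤m ⟩
    suc (m ∸ suc (toℕ i))         ≡⟨ cong (λ x → suc (m ∸ x)) i⋖i+1 ⟨
    suc (m ∸ toℕ (next i))        ≡⟨ cong suc (opposite-prop (next i)) ⟨
    suc (toℕ (opposite (next i))) ∎)
    where
      open ≡-Reasoning
      i+1≤m : suc (toℕ i) ≤ m
      i+1≤m = s≤s⁻¹ (subst (_< N) i⋖i+1 (toℕ<n (next i)))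
  ... | inj₂ (last , i+1≡0) = next-last
    (cong suc (trans (opposite-prop (next i)) (cong (m ∸_) i+1≡0)))
    (trans (opposite-prop i) (trans (cong (_∸ toℕ i) (suc-injective (sym last))) (n∸n≡0 (toℕ i))))

  next²≢id : 3 ≤ N → ∀ (i : Fin N) → next (next i) ≢ i
  next²≢id 3≤N i e with next-cases i | next-cases (next i) | cong toℕ e
  ... | inj₁ i⋖i′ | inj₁ i′⋖i″ | i″≡i =
    m≢1+n+m (toℕ i) (trans (sym i″≡i) (trans i′⋖i″ (cong suc i⋖i′)))
  ... | inj₁ i⋖i′ | inj₂ (i′-last , i″≡0) | i″≡i =
    <⇒≢ 3≤N (sym (trans (sym i′-last) (cong suc (trans i⋖i′ (cong suc (trans (sym i″≡i) i″≡0))))))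
  ... | inj₂ (i-last , i′≡0) | inj₁ i′⋖i″ | i″≡i =
    <⇒≢ 3≤N (sym (trans (sym i-last) (cong suc (trans (sym i″≡i) (trans i′⋖i″ (cong suc i′≡0))))))
  ... | inj₂ (_ , i′≡0) | inj₂ (i′-last , _) | _ =
    <⇒≢ (≤-trans (s≤s (s≤s z≤n)) 3≤N) (sym (trans (sym i′-last) (cong suc i′≡0)))

-- Hamiltonian cycles as cyclic successor functions

module _ {m : ℕ} {G : Graph (suc m)} where

  private
    N : ℕ
    N = suc m

  σ⁻¹ : HamCycle G → Fin N → Fin N
  σ⁻¹ C x = proj₁ (proj₂ (bij C) x)

  σ-σ⁻¹ : ∀ C x → σ C (σ⁻¹ C x) ≡ x
  σ-σ⁻¹ C x = proj₂ (proj₂ (bij C) x) refl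

  succ : HamCycle G → Fin N → Fin N
  succ C x = σ C (next (σ⁻¹ C x))

  succ-σ : ∀ C i → succ C (σ C i) ≡ σ C (next i)
  succ-σ C i = cong (σ C ∘ next) (proj₁ (bij C) (σ-σ⁻¹ C (σ C i)))

  succ-adj : ∀ C x → Adj G x (succ C x)
  succ-adj C x = subst (λ y → Adj G y (succ C x)) (σ-σ⁻¹ C x) (adj C (σ⁻¹ C x))

  succ-injective : ∀ C → Injective _≡_ _≡_ (succ C)
  succ-injective C {x} {y} e = begin
    x                ≡⟨ σ-σ⁻¹ C x ⟨
    σ C (σ⁻¹ C x)    ≡⟨ cong (σ C) (proj₁ next-bijective (proj₁ (bij C) e)) ⟩
    σ C (σ⁻¹ C y)    ≡⟨ σ-σ⁻¹ C y ⟩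
    y                ∎
    where open ≡-Reasoning

  fold-succ : ∀ C p t → fold (σ C p) (succ C) t ≡ σ C (fold p next t)
  fold-succ C p zero    = refl
  fold-succ C p (suc t) = trans (cong (succ C) (fold-succ C p t)) (succ-σ C _)

  fold-succ-period : ∀ C x → fold x (succ C) N ≡ x
  fold-succ-period C x = subst (λ y → fold y (succ C) N ≡ y) (σ-σ⁻¹ C x)
    (trans (fold-succ C _ N) (cong (σ C) (fold-next-period _)))

  succ²≢id : 3 ≤ N → ∀ C x → succ C (succ C x) ≢ x
  succ²≢id 3≤N C x e = next²≢id 3≤N p (proj₁ (bij C) (begin
    σ C (next (next p))           ≡⟨ fold-succ C p 2 ⟨
    succ C (succ C (σ C p))       ≡⟨ cong (λ y → succ C (succ C y)) (σ-σ⁻¹ C x) ⟩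
    succ C (succ C x)             ≡⟨ e ⟩
    x                             ≡⟨ σ-σ⁻¹ C x ⟨
    σ C p                         ∎))
    where
      open ≡-Reasoning
      p = σ⁻¹ C x

  rotate : HamCycle G → Fin N → HamCycle G
  rotate C x = record
    { σ   = σ C ∘ shift
    ; bij = Comp.bijective _≡_ _≡_ _≡_ (fold-bijective next-bijective r) (bij C)
    ; adj = λ i → subst (Adj G (σ C (shift i)) ∘ σ C) (sym (fold-suc next i r)) (adj C (shift i))
    }
    where
      r = toℕ (σ⁻¹ C x)
      shift : Fin N → Fin N
      shift i = fold i next r

  σ-rotate : ∀ C x i → σ (rotate C x) i ≡ fold x (succ C) (toℕ i)
  σ-rotate C x i = begin
    σ C (fold i next (toℕ p))      ≡⟨ cong (σ C) (fold-next-comm i p) ⟩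
    σ C (fold p next (toℕ i))      ≡⟨ fold-succ C p (toℕ i) ⟨
    fold (σ C p) (succ C) (toℕ i)  ≡⟨ cong (λ y → fold y (succ C) (toℕ i)) (σ-σ⁻¹ C x) ⟩
    fold x (succ C) (toℕ i)        ∎
    where
      open ≡-Reasoning
      p = σ⁻¹ C x

  reverse : HamCycle G → HamCycle G
  reverse C = record
    { σ   = σ C ∘ opposite
    ; bij = Comp.bijective _≡_ _≡_ _≡_ opposite-bijective (bij C)
    ; adj = λ i → Adj-sym G (subst (Adj G (σ C (opposite (next i))) ∘ σ C) (next-opposite i) (adj C (opposite (next i))))
    }

  succ-reverse : ∀ C x → succ (reverse C) (succ C x) ≡ x
  succ-reverse C x = subst (λ y → succ (reverse C) (succ C y) ≡ y) (σ-σ⁻¹ C x) (begin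
    succ (reverse C) (succ C (σ C p))                      ≡⟨ cong (succ (reverse C)) (succ-σ C p) ⟩
    succ (reverse C) (σ C (next p))                        ≡⟨ cong (succ (reverse C) ∘ σ C) (opposite-involutive (next p)) ⟨
    succ (reverse C) (σ (reverse C) (opposite (next p)))   ≡⟨ succ-σ (reverse C) (opposite (next p)) ⟩
    σ C (opposite (next (opposite (next p))))              ≡⟨ cong (σ C ∘ opposite) (next-opposite p) ⟩
    σ C (opposite (opposite p))                            ≡⟨ cong (σ C) (opposite-involutive p) ⟩
    σ C p                                                  ∎)
    where
      open ≡-Reasoning
      p = σ⁻¹ C x

  Traverses : HamCycle G → Fin N → Fin N → Set
  Traverses C x y = succ C x ≡ y ⊎ succ C y ≡ x

  orient : ∀ C {x y} → Traverses C x y → Σ (HamCycle G) λ C′ → succ C′ x ≡ y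
  orient C (inj₁ x↦y) = C , x↦y
  orient C {x} {y} (inj₂ y↦x) = reverse C , trans (cong (succ (reverse C)) (sym y↦x)) (succ-reverse C y)

  passes⇒traverses : ∀ C {a b} → PassesThrough C a b → Traverses C a b
  passes⇒traverses C (i , inj₁ (σi≡a , σi+1≡b)) = inj₁ (trans (cong (succ C) (sym σi≡a)) (trans (succ-σ C i) σi+1≡b))
  passes⇒traverses C (i , inj₂ (σi≡b , σi+1≡a)) = inj₂ (trans (cong (succ C) (sym σi≡b)) (trans (succ-σ C i) σi+1≡a))

  succ⁻¹ : HamCycle G → Fin N → Fin N
  succ⁻¹ C x = fold x (succ C) m

  succ-succ⁻¹ : ∀ C x → succ C (succ⁻¹ C x) ≡ x
  succ-succ⁻¹ = fold-succ-period

  -- succ C x and succ⁻¹ C x are two neighbours of x, distinct since there are no 2-cycles.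
  traverses-sole-neighbours : 3 ≤ N → ∀ C {x c d} → (∀ {z} → Adj G x z → z ≡ c ⊎ z ≡ d) → Traverses C x c
  traverses-sole-neighbours 3≤N C {x} neighbours
    with neighbours (succ-adj C x)
       | neighbours (Adj-sym G (subst (Adj G (succ⁻¹ C x)) (succ-succ⁻¹ C x) (succ-adj C (succ⁻¹ C x))))
  ... | inj₁ x↦c | _        = inj₁ x↦c
  ... | inj₂ _   | inj₁ q≡c = inj₂ (trans (cong (succ C) (sym q≡c)) (succ-succ⁻¹ C x))
  ... | inj₂ x↦d | inj₂ q≡d = ⊥-elim (succ²≢id 3≤N C x (begin
    succ C (succ C x)           ≡⟨ cong (succ C) (trans x↦d (sym q≡d)) ⟩
    succ C (succ⁻¹ C x)         ≡⟨ succ-succ⁻¹ C x ⟩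
    x                           ∎))
    where open ≡-Reasoning

  adj-consecutive : ∀ (C : HamCycle G) {i j} → Consecutive i j → Adj G (σ C i) (σ C j)
  adj-consecutive C {i} i⋖j = subst (Adj G (σ C i) ∘ σ C) (next-consecutive i⋖j) (adj C i)

  adj-last : ∀ (C : HamCycle G) {i j} → IsLast i → toℕ j ≡ 0 → Adj G (σ C i) (σ C j)
  adj-last C {i} last j≡0 = subst (Adj G (σ C i) ∘ σ C) (next-last last j≡0) (adj C i)

  mkHamCycle : (τ : Fin N → Fin N) → Bijective _≡_ _≡_ τ →
               (∀ {i j} → Consecutive i j → Adj G (τ i) (τ j)) →
               (∀ {i j} → IsLast i → toℕ j ≡ 0 → Adj G (τ i) (τ j)) →
               HamCycle G
  mkHamCycle τ τ-bij consecutive wrap = record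
    { σ   = τ
    ; bij = τ-bij
    ; adj = λ i → [ consecutive , uncurry wrap ]′ (next-cases i)
    }

  PathFromTo : HamCycle G → Fin (suc m) → Fin (suc m) → Set
  PathFromTo C b a = (∀ {j} → toℕ j ≡ 0 → σ C j ≡ b) × (∀ {i} → IsLast i → σ C i ≡ a)

  cut-at-edge : ∀ (C : HamCycle G) {a b} → PassesThrough C a b → Σ (HamCycle G) λ C′ → PathFromTo C′ b a
  cut-at-edge C {a} {b} p with orient C (passes⇒traverses C p)
  ... | C₁ , a↦b = rotate C₁ b , starts-at-b , ends-at-a
    where
      open ≡-Reasoning
      starts-at-b : ∀ {j} → toℕ j ≡ 0 → σ (rotate C₁ b) j ≡ b
      starts-at-b {j} j≡0 = trans (σ-rotate C₁ b j) (cong (fold b (succ C₁)) j≡0)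
      ends-at-a : ∀ {i} → IsLast i → σ (rotate C₁ b) i ≡ a
      ends-at-a {i} last = succ-injective C₁ (begin
        succ C₁ (σ (rotate C₁ b) i)          ≡⟨ cong (succ C₁) (σ-rotate C₁ b i) ⟩
        fold b (succ C₁) (suc (toℕ i))       ≡⟨ cong (fold b (succ C₁)) last ⟩
        fold b (succ C₁) (suc m)             ≡⟨ fold-succ-period C₁ b ⟩
        b                                    ≡⟨ a↦b ⟨
        succ C₁ a                            ∎)

-- Counting neighbours

injective-∷ : ∀ {A : Set} {r} {a : A} {f : Fin r → A} →
              (∀ i → a ≢ f i) → Injective _≡_ _≡_ f → Injective _≡_ _≡_ (a ∷ f)
injective-∷ a∉f f-inj {zero}  {zero}  _ = refl
injective-∷ a∉f f-inj {zero}  {suc j} e = ⊥-elim (a∉f j e)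
injective-∷ a∉f f-inj {suc i} {zero}  e = ⊥-elim (a∉f i (sym e))
injective-∷ a∉f f-inj {suc i} {suc j} e = cong suc (f-inj e)

[]-injective : ∀ {A : Set} → Injective _≡_ _≡_ ([] {A = A})
[]-injective {x = ()}

module _ {N : ℕ} (G : Graph N) {x : Fin N} where

  deg-≥ : ∀ {r} (f : Fin r → Fin N) → Injective _≡_ _≡_ f → (∀ i → Adj G x (f i)) → r ≤ deg G x
  deg-≥ {r} f f-inj x~f = injective⇒≤ position-injective
    where
      position : Fin r → Fin (deg G x)
      position i = index (∈-filter⁺ (T? ∘ E G x) (∈-allFin (f i)) (subst T (sym (x~f i)) _))
      position-injective : Injective _≡_ _≡_ position
      position-injective e = f-inj (index-injective (setoid (Fin N)) _ _ e)

  neighbour-among : ∀ {r} (f : Fin r → Fin N) → Injective _≡_ _≡_ f → (∀ i → Adj G x (f i)) →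
                    deg G x ≤ r → ∀ {z} → Adj G x z → ∃ λ i → z ≡ f i
  neighbour-among f f-inj x~f deg≤r {z} x~z with any? (λ i → z ≟ f i)
  ... | yes z∈f = z∈f
  ... | no  z∉f = ⊥-elim (1+n≰n (≤-trans (deg-≥ (z ∷ f) (injective-∷ (λ i e → z∉f (i , e)) f-inj) x~z∷f) deg≤r))
    where
      x~z∷f : ∀ i → Adj G x ((z ∷ f) i)
      x~z∷f zero    = x~z
      x~z∷f (suc i) = x~f i

  neighbours-of-deg≤2 : ∀ {a b} → deg G x ≤ 2 → a ≢ b → Adj G x a → Adj G x b →
                        ∀ {z} → Adj G x z → z ≡ a ⊎ z ≡ b
  neighbours-of-deg≤2 {a} {b} deg≤2 a≢b x~a x~b x~z
    with neighbour-among (a ∷ b ∷ []) (injective-∷ (λ { zero → a≢b }) (injective-∷ (λ ()) []-injective))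
                         (λ { zero → x~a ; (suc zero) → x~b }) deg≤2 x~z
  ... | zero     , z≡a = inj₁ z≡a
  ... | suc zero , z≡b = inj₂ z≡b

  neighbours-of-deg≤3 : ∀ {a b c} → deg G x ≤ 3 → a ≢ b → a ≢ c → b ≢ c →
                        Adj G x a → Adj G x b → Adj G x c →
                        ∀ {z} → Adj G x z → z ≡ a ⊎ z ≡ b ⊎ z ≡ c
  neighbours-of-deg≤3 {a} {b} {c} deg≤3 a≢b a≢c b≢c x~a x~b x~c x~z
    with neighbour-among (a ∷ b ∷ c ∷ [])
           (injective-∷ (λ { zero → a≢b ; (suc zero) → a≢c }) (injective-∷ (λ { zero → b≢c }) (injective-∷ (λ ()) []-injective)))
           (λ { zero → x~a ; (suc zero) → x~b ; (suc (suc zero)) → x~c }) deg≤3 x~z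
  ... | zero           , z≡a = inj₁ z≡a
  ... | suc zero       , z≡b = inj₂ (inj₁ z≡b)
  ... | suc (suc zero) , z≡c = inj₂ (inj₂ z≡c)

-- The two blocks of Fin (m + k)

module _ {m k : ℕ} where

  ↑-cases : ∀ (x : Fin (m + k)) → (∃ λ i → x ≡ i ↑ˡ k) ⊎ (∃ λ j → x ≡ m ↑ʳ j)
  ↑-cases x with splitAt m x in eq
  ... | inj₁ i = inj₁ (i , sym (splitAt⁻¹-↑ˡ eq))
  ... | inj₂ j = inj₂ (j , sym (splitAt⁻¹-↑ʳ eq))

  toℕ-↑ˡ<toℕ-↑ʳ : ∀ (i : Fin m) (j : Fin k) → toℕ (i ↑ˡ k) < toℕ (m ↑ʳ j)
  toℕ-↑ˡ<toℕ-↑ʳ i j = subst₂ _<_ (sym (toℕ-↑ˡ i k)) (sym (toℕ-↑ʳ m j)) (<-≤-trans (toℕ<n i) (m≤m+n m (toℕ j)))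

  ↑ˡ≢↑ʳ : ∀ (i : Fin m) (j : Fin k) → i ↑ˡ k ≢ m ↑ʳ j
  ↑ˡ≢↑ʳ i j e = <⇒≢ (toℕ-↑ˡ<toℕ-↑ʳ i j) (cong toℕ e)

  consecutive-↑ˡ : ∀ {i j : Fin m} → Consecutive i j → Consecutive (i ↑ˡ k) (j ↑ˡ k)
  consecutive-↑ˡ {i} {j} i⋖j = trans (toℕ-↑ˡ j k) (trans i⋖j (cong suc (sym (toℕ-↑ˡ i k))))

  consecutive-↑ʳ : ∀ {i j : Fin k} → Consecutive i j → Consecutive (m ↑ʳ i) (m ↑ʳ j)
  consecutive-↑ʳ {i} {j} i⋖j = begin
    toℕ (m ↑ʳ j)        ≡⟨ toℕ-↑ʳ m j ⟩
    m + toℕ j           ≡⟨ cong (m +_) i⋖j ⟩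
    m + suc (toℕ i)     ≡⟨ +-suc m (toℕ i) ⟩
    suc (m + toℕ i)     ≡⟨ cong suc (toℕ-↑ʳ m i) ⟨
    suc (toℕ (m ↑ʳ i))  ∎
    where open ≡-Reasoning

  consecutive-↑ˡ↑ʳ : ∀ {i : Fin m} {j : Fin k} → IsLast i → toℕ j ≡ 0 → Consecutive (i ↑ˡ k) (m ↑ʳ j)
  consecutive-↑ˡ↑ʳ {i} {j} last j≡0 = begin
    toℕ (m ↑ʳ j)        ≡⟨ toℕ-↑ʳ m j ⟩
    m + toℕ j           ≡⟨ cong (m +_) j≡0 ⟩
    m + 0               ≡⟨ +-identityʳ m ⟩
    m                   ≡⟨ last ⟨
    suc (toℕ i)         ≡⟨ cong suc (toℕ-↑ˡ i k) ⟨
    suc (toℕ (i ↑ˡ k))  ∎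
    where open ≡-Reasoning

  last-↑ʳ : ∀ {j : Fin k} → IsLast j → IsLast (m ↑ʳ j)
  last-↑ʳ {j} last = trans (cong suc (toℕ-↑ʳ m j)) (trans (sym (+-suc m (toℕ j))) (cong (m +_) last))

  module _ (P : Fin (m + k) → Fin (m + k) → Set) where

    consecutive-↑-elim : (∀ {i j} → Consecutive i j → P (i ↑ˡ k) (j ↑ˡ k)) →
                         (∀ {i j} → IsLast i → toℕ j ≡ 0 → P (i ↑ˡ k) (m ↑ʳ j)) →
                         (∀ {i j} → Consecutive i j → P (m ↑ʳ i) (m ↑ʳ j)) →
                         ∀ {x y} → Consecutive x y → P x y
    consecutive-↑-elim left boundary right {x} {y} x⋖y with ↑-cases x | ↑-cases y
    ... | inj₁ (i , refl) | inj₁ (j , refl) =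
      left (trans (sym (toℕ-↑ˡ j k)) (trans x⋖y (cong suc (toℕ-↑ˡ i k))))
    ... | inj₁ (i , refl) | inj₂ (j , refl) = boundary last j≡0
      where
        m+j≡1+i : m + toℕ j ≡ suc (toℕ i)
        m+j≡1+i = trans (sym (toℕ-↑ʳ m j)) (trans x⋖y (cong suc (toℕ-↑ˡ i k)))
        last : IsLast i
        last = ≤-antisym (toℕ<n i) (subst (m ≤_) m+j≡1+i (m≤m+n m (toℕ j)))
        j≡0 : toℕ j ≡ 0
        j≡0 = +-cancelˡ-≡ m (toℕ j) 0 (trans m+j≡1+i (trans last (sym (+-identityʳ m))))
    ... | inj₂ (i , refl) | inj₁ (j , refl) =
      ⊥-elim (<⇒≱ (toℕ-↑ˡ<toℕ-↑ʳ j i) (subst (toℕ (m ↑ʳ i) ≤_) (sym x⋖y) (n≤1+n _)))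
    ... | inj₂ (i , refl) | inj₂ (j , refl) =
      right (+-cancelˡ-≡ m _ _ (trans (sym (toℕ-↑ʳ m j)) (trans x⋖y (trans (cong suc (toℕ-↑ʳ m i)) (sym (+-suc m (toℕ i)))))))

    wrap-↑-elim : 0 < m → 0 < k → (∀ {i j} → IsLast i → toℕ j ≡ 0 → P (m ↑ʳ i) (j ↑ˡ k)) →
                  ∀ {x y} → IsLast x → toℕ y ≡ 0 → P x y
    wrap-↑-elim 0<m 0<k wrap {x} {y} last y≡0 with ↑-cases x | ↑-cases y
    ... | inj₁ (i , refl) | _ =
      ⊥-elim (<⇒≱ (m<m+n m 0<k) (subst (_≤ m) (trans (cong suc (sym (toℕ-↑ˡ i k))) last) (toℕ<n i)))
    ... | inj₂ _ | inj₂ (j , refl) =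
      ⊥-elim (<⇒≱ 0<m (subst (m ≤_) (trans (sym (toℕ-↑ʳ m j)) y≡0) (m≤m+n m (toℕ j))))
    ... | inj₂ (i , refl) | inj₁ (j , refl) = wrap i-last (trans (sym (toℕ-↑ˡ j k)) y≡0)
      where
        i-last : IsLast i
        i-last = +-cancelˡ-≡ m _ _ (trans (+-suc m (toℕ i)) (trans (cong suc (sym (toℕ-↑ʳ m i))) last))

  extendʳ : (Fin m → Fin m) → Fin (m + k) → Fin (m + k)
  extendʳ g = join m k ∘ map₁ g ∘ splitAt m

  extendʳ-↑ˡ : ∀ g i → extendʳ g (i ↑ˡ k) ≡ g i ↑ˡ k
  extendʳ-↑ˡ g i = cong (join m k ∘ map₁ g) (splitAt-↑ˡ m i k)

  extendʳ-↑ʳ : ∀ g j → extendʳ g (m ↑ʳ j) ≡ m ↑ʳ j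
  extendʳ-↑ʳ g j = cong (join m k ∘ map₁ g) (splitAt-↑ʳ m k j)

  extendʳ-bijective : ∀ {g} → Bijective _≡_ _≡_ g → Bijective _≡_ _≡_ (extendʳ g)
  extendʳ-bijective {g} (g-inj , g-surj) = injective , strictlySurjective⇒surjective surjective
    where
      injective : Injective _≡_ _≡_ (extendʳ g)
      injective {x} {y} e with ↑-cases x | ↑-cases y
      ... | inj₁ (i , refl) | inj₁ (j , refl) =
        cong (_↑ˡ k) (g-inj (↑ˡ-injective k _ _ (trans (sym (extendʳ-↑ˡ g i)) (trans e (extendʳ-↑ˡ g j)))))
      ... | inj₁ (i , refl) | inj₂ (j , refl) =
        ⊥-elim (↑ˡ≢↑ʳ (g i) j (trans (sym (extendʳ-↑ˡ g i)) (trans e (extendʳ-↑ʳ g j))))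
      ... | inj₂ (i , refl) | inj₁ (j , refl) =
        ⊥-elim (↑ˡ≢↑ʳ (g j) i (trans (sym (extendʳ-↑ˡ g j)) (trans (sym e) (extendʳ-↑ʳ g i))))
      ... | inj₂ (i , refl) | inj₂ (j , refl) =
        cong (m ↑ʳ_) (↑ʳ-injective m _ _ (trans (sym (extendʳ-↑ʳ g i)) (trans e (extendʳ-↑ʳ g j))))

      surjective : StrictlySurjective _≡_ (extendʳ g)
      surjective y with ↑-cases y
      ... | inj₁ (i , refl) = proj₁ (g-surj i) ↑ˡ k , trans (extendʳ-↑ˡ g _) (cong (_↑ˡ k) (proj₂ (g-surj i) refl))
      ... | inj₂ (j , refl) = m ↑ʳ j , extendʳ-↑ʳ g j

  module _ {f : Fin (m + k) → Fin (m + k)} (f-bij : Bijective _≡_ _≡_ f)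
           (f-fixes : ∀ j → f (m ↑ʳ j) ≡ m ↑ʳ j) where

    private
      image-↑ˡ : ∀ i → ∃ λ i′ → f (i ↑ˡ k) ≡ i′ ↑ˡ k
      image-↑ˡ i with ↑-cases (f (i ↑ˡ k))
      ... | inj₁ image  = image
      ... | inj₂ (j , e) = ⊥-elim (↑ˡ≢↑ʳ i j (proj₁ f-bij (trans e (sym (f-fixes j)))))

    restrictˡ : Fin m → Fin m
    restrictˡ i = proj₁ (image-↑ˡ i)

    restrictˡ-↑ˡ : ∀ i → f (i ↑ˡ k) ≡ restrictˡ i ↑ˡ k
    restrictˡ-↑ˡ i = proj₂ (image-↑ˡ i)

    restrictˡ-bijective : Bijective _≡_ _≡_ restrictˡ
    restrictˡ-bijective = injective , strictlySurjective⇒surjective surjective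
      where
        injective : Injective _≡_ _≡_ restrictˡ
        injective {i} {j} e =
          ↑ˡ-injective k i j (proj₁ f-bij (trans (restrictˡ-↑ˡ i) (trans (cong (_↑ˡ k) e) (sym (restrictˡ-↑ˡ j)))))

        surjective : StrictlySurjective _≡_ restrictˡ
        surjective i′ with proj₂ f-bij (i′ ↑ˡ k)
        ... | x , fx≡i′ with ↑-cases x
        ...   | inj₁ (i , refl) = i , ↑ˡ-injective k _ _ (trans (sym (restrictˡ-↑ˡ i)) (fx≡i′ refl))
        ...   | inj₂ (j , refl) = ⊥-elim (↑ˡ≢↑ʳ i′ j (trans (sym (fx≡i′ refl)) (f-fixes j)))

-- Attaching a cycle

module Attached {n k : ℕ} {G : Graph (suc n)} {u₁ u₂ : Fin (suc n)} {G′ : Graph (suc n + suc (suc k))}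
                (att : AttachCycle G u₁ u₂ (suc (suc k)) G′) where

  open AttachCycle att

  private
    K N : ℕ
    K = suc (suc k)
    N = suc n + K

  old : Fin (suc n) → Fin N
  old x = x ↑ˡ K

  -- walk t is the paper's v_{(t mod k) + 1}, so walk t, walk (suc t) is always an edge of the
  -- attached cycle, including the closing edge v_k v_1.
  walk : ℕ → Fin N
  walk t = suc n ↑ʳ (t mod K)

  2≤k : 2 ≤ k
  2≤k = s≤s⁻¹ (s≤s⁻¹ k≥4)

  walk-toℕ : ∀ i → walk (toℕ i) ≡ suc n ↑ʳ i
  walk-toℕ i = cong (suc n ↑ʳ_) (mod-toℕ i)

  walk-adj : ∀ t → Adj G′ (walk t) (walk (suc t))
  walk-adj t = Equivalence.from (cycle (t mod K) (suc t mod K)) (inj₁ (sym (next-mod t)))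

  walk-period : walk K ≡ walk 0
  walk-period = cong (suc n ↑ʳ_) (toℕ-injective (trans (toℕ-fromℕ< _) (n%n≡0 K)))

  walk-injective : ∀ {t t′} → t < K → t′ < K → walk t ≡ walk t′ → t ≡ t′
  walk-injective t<K t′<K e = trans (sym (toℕ-mod t<K)) (trans (cong toℕ (↑ʳ-injective (suc n) _ _ e)) (toℕ-mod t′<K))

  walk≢old : ∀ t x → walk t ≢ old x
  walk≢old t x e = ↑ˡ≢↑ʳ x _ (sym e)

  deg-walk-first : deg G′ (walk 0) ≡ 3
  deg-walk-first = deg-first _ refl

  deg-walk-last : deg G′ (walk (suc k)) ≡ 3
  deg-walk-last = deg-last _ (toℕ-mod ≤-refl)

  sparse-walk : ∀ t → 2 + t < K → 3 ≤ deg G′ (walk (suc t)) →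
                deg G′ (walk t) ≡ 2 × deg G′ (walk (2 + t)) ≡ 2
  sparse-walk t 2+t<K = sparse _ _ _
    (trans (toℕ-mod 1+t<K) (cong suc (sym (toℕ-mod (<-trans (n<1+n t) 1+t<K)))))
    (trans (toℕ-mod 2+t<K) (cong suc (sym (toℕ-mod 1+t<K))))
    where
      1+t<K : suc t < K
      1+t<K = <-trans (n<1+n (suc t)) 2+t<K

  inner-neighbours : ∀ t → 2 + t < K → deg G′ (walk (suc t)) ≤ 2 →
                     ∀ {z} → Adj G′ (walk (suc t)) z → z ≡ walk t ⊎ z ≡ walk (2 + t)
  inner-neighbours t 2+t<K deg≤2 = neighbours-of-deg≤2 G′ deg≤2
    (λ e → m≢1+n+m t (walk-injective (<-trans (<-trans (n<1+n t) (n<1+n (suc t))) 2+t<K) 2+t<K e))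
    (Adj-sym G′ (walk-adj t)) (walk-adj (suc t))

  first~last : Adj G′ (walk 0) (walk (suc k))
  first~last = Adj-sym G′ (subst (Adj G′ (walk (suc k))) walk-period (walk-adj (suc k)))

  old-neighbour-of-first : ∀ {x} → Adj G′ (walk 0) (old x) → x ≡ u₁
  old-neighbour-of-first {x} x~ =
    [ (λ e → ⊥-elim (walk≢old 1 x (sym e))) , [ (λ e → ⊥-elim (walk≢old (suc k) x (sym e))) , ↑ˡ-injective K x u₁ ]′ ]′
    (neighbours-of-deg≤3 G′ (≤-reflexive deg-walk-first)
      (λ e → <⇒≢ (s≤s (≤-trans (n≤1+n 1) 2≤k)) (walk-injective (s≤s (s≤s z≤n)) ≤-refl e))
      (walk≢old 1 u₁) (walk≢old (suc k) u₁)
      (walk-adj 0) first~last (edge-first _ refl) x~)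

  old-neighbour-of-last : ∀ {x} → Adj G′ (walk (suc k)) (old x) → x ≡ u₂
  old-neighbour-of-last {x} x~ =
    [ (λ e → ⊥-elim (walk≢old k x (sym e))) , [ (λ e → ⊥-elim (walk≢old 0 x (sym e))) , ↑ˡ-injective K x u₂ ]′ ]′
    (neighbours-of-deg≤3 G′ (≤-reflexive deg-walk-last)
      (λ e → <⇒≢ (≤-trans (s≤s z≤n) 2≤k) (sym (walk-injective (<-trans (n<1+n k) (n<1+n (suc k))) (s≤s z≤n) e)))
      (walk≢old k u₂) (walk≢old 0 u₂)
      (Adj-sym G′ (walk-adj k)) (Adj-sym G′ first~last) (edge-last _ (toℕ-mod ≤-refl)) x~)

  2<K : 2 < K
  2<K = s≤s (s≤s (≤-trans (s≤s z≤n) 2≤k))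

  3≤N : 3 ≤ N
  3≤N = ≤-trans 2<K (m≤n+m K (suc n))

  module _ (H : HamCycle G′) where

    inner-traversed : ∀ t → 2 + t < K → deg G′ (walk (suc t)) ≤ 2 →
                      Traverses H (walk (suc t)) (walk t) × Traverses H (walk (suc t)) (walk (2 + t))
    inner-traversed t 2+t<K deg≤2 =
        traverses-sole-neighbours 3≤N H (inner-neighbours t 2+t<K deg≤2)
      , traverses-sole-neighbours 3≤N H (swap ∘ inner-neighbours t 2+t<K deg≤2)

    -- The degree conditions make one endpoint of each path edge an inner vertex of degree at most 2.
    path-traversed : ∀ t → suc t < K → Traverses H (walk t) (walk (suc t))
    path-traversed zero _ with 3 ≤? deg G′ (walk 1)
    ... | yes 3≤deg = ⊥-elim (<⇒≢ (n<1+n 2) (trans (sym (proj₁ (sparse-walk 0 2<K 3≤deg))) deg-walk-first))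
    ... | no  3≰deg = swap (proj₁ (inner-traversed 0 2<K (s≤s⁻¹ (≰⇒> 3≰deg))))
    path-traversed (suc t) 2+t<K with 3 ≤? deg G′ (walk (suc t))
    ... | no  3≰deg = proj₂ (inner-traversed t 2+t<K (s≤s⁻¹ (≰⇒> 3≰deg)))
    ... | yes 3≤deg with 3 + t <? K
    ...   | yes 3+t<K = swap (proj₁ (inner-traversed (suc t) 3+t<K (≤-reflexive (proj₂ (sparse-walk t 2+t<K 3≤deg)))))
    ...   | no  3+t≮K = ⊥-elim (<⇒≢ (n<1+n 2) (begin
      2                          ≡⟨ proj₂ (sparse-walk t 2+t<K 3≤deg) ⟨
      deg G′ (walk (2 + t))      ≡⟨ cong (deg G′ ∘ walk) (suc-injective (≤-antisym 2+t<K (≮⇒≥ 3+t≮K))) ⟩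
      deg G′ (walk (suc k))      ≡⟨ deg-walk-last ⟩
      3                          ∎))
      where open ≡-Reasoning

    walk-forward : succ H (walk 0) ≡ walk 1 → ∀ t → suc t < K → succ H (walk t) ≡ walk (suc t)
    walk-forward first↦ zero    _     = first↦
    walk-forward first↦ (suc t) 2+t<K with path-traversed (suc t) 2+t<K
    ... | inj₁ forward  = forward
    ... | inj₂ backward = ⊥-elim (m≢1+n+m t (sym (walk-injective 2+t<K t<K
            (succ-injective H (trans backward (sym (walk-forward first↦ t 1+t<K)))))))
      where
        1+t<K : suc t < K
        1+t<K = <-trans (n<1+n _) 2+t<K
        t<K : t < K
        t<K = <-trans (n<1+n t) 1+t<K

    fold-walk : succ H (walk 0) ≡ walk 1 → ∀ t → t < K → fold (walk 0) (succ H) t ≡ walk t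
    fold-walk first↦ zero    _     = refl
    fold-walk first↦ (suc t) 1+t<K =
      trans (cong (succ H) (fold-walk first↦ t (<-trans (n<1+n t) 1+t<K))) (walk-forward first↦ t 1+t<K)

  Aligned : HamCycle G′ → Set
  Aligned H = ∀ j → σ H (suc n ↑ʳ j) ≡ suc n ↑ʳ j

  align : HamCycle G′ → Σ (HamCycle G′) Aligned
  align H with orient H (path-traversed H 0 (s≤s (s≤s z≤n)))
  ... | H₁ , first↦ = rotate H₁ x₀ , aligned
    where
      s = succ H₁
      -- Starting k steps after v_1 puts v_1 at position n.
      x₀ = fold (walk 0) s K
      aligned : Aligned (rotate H₁ x₀)
      aligned j = begin
        σ (rotate H₁ x₀) (suc n ↑ʳ j)           ≡⟨ σ-rotate H₁ x₀ _ ⟩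
        fold x₀ s (toℕ (suc n ↑ʳ j))            ≡⟨ cong (fold x₀ s) (toℕ-↑ʳ (suc n) j) ⟩
        fold x₀ s (suc n + toℕ j)               ≡⟨ fold-+ (walk 0) s (suc n + toℕ j) ⟨
        fold (walk 0) s (suc n + toℕ j + K)     ≡⟨ cong (fold (walk 0) s) (trans (cong (_+ K) (+-comm (suc n) (toℕ j))) (+-assoc (toℕ j) (suc n) K)) ⟩
        fold (walk 0) s (toℕ j + N)             ≡⟨ fold-+ (walk 0) s (toℕ j) ⟩
        fold (fold (walk 0) s N) s (toℕ j)      ≡⟨ cong (λ y → fold y s (toℕ j)) (fold-succ-period H₁ (walk 0)) ⟩
        fold (walk 0) s (toℕ j)                 ≡⟨ fold-walk H₁ first↦ (toℕ j) (toℕ<n j) ⟩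
        walk (toℕ j)                            ≡⟨ walk-toℕ j ⟩
        suc n ↑ʳ j                              ∎
        where open ≡-Reasoning

  extract : (H : HamCycle G′) → Aligned H → Adj G u₁ u₂ → HamCycle G
  extract H aligned u₁~u₂ = mkHamCycle τ (restrictˡ-bijective (bij H) aligned) consecutive wrap
    where
      τ : Fin (suc n) → Fin (suc n)
      τ = restrictˡ (bij H) aligned

      τ-old : ∀ i → σ H (old i) ≡ old (τ i)
      τ-old = restrictˡ-↑ˡ (bij H) aligned

      consecutive : ∀ {i j} → Consecutive i j → Adj G (τ i) (τ j)
      consecutive {i} {j} i⋖j =
        trans (sym (restrict (τ i) (τ j))) (subst₂ (Adj G′) (τ-old i) (τ-old j) (adj-consecutive H (consecutive-↑ˡ i⋖j)))

      τ-last : ∀ {i} → IsLast i → τ i ≡ u₁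
      τ-last {i} last = old-neighbour-of-first (Adj-sym G′
        (subst₂ (Adj G′) (τ-old i) (aligned zero) (adj-consecutive H (consecutive-↑ˡ↑ʳ last refl))))

      τ-first : ∀ {j} → toℕ j ≡ 0 → τ j ≡ u₂
      τ-first {j} j≡0 = old-neighbour-of-last
        (subst₂ (Adj G′) (aligned (suc k mod K)) (τ-old j)
          (adj-last H (last-↑ʳ {m = suc n} (cong suc (toℕ-mod ≤-refl))) (trans (toℕ-↑ˡ j K) j≡0)))

      wrap : ∀ {i j} → IsLast i → toℕ j ≡ 0 → Adj G (τ i) (τ j)
      wrap last j≡0 = subst₂ (Adj G) (sym (τ-last last)) (sym (τ-first j≡0)) u₁~u₂

  insert : (C : HamCycle G) → PathFromTo C u₂ u₁ → HamCycle G′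
  insert C (starts-at-u₂ , ends-at-u₁) =
    mkHamCycle σ′ (extendʳ-bijective (bij C))
      (consecutive-↑-elim P left boundary right)
      (wrap-↑-elim P (s≤s z≤n) (s≤s z≤n) wrap)
    where
      σ′ : Fin N → Fin N
      σ′ = extendʳ (σ C)

      P : Fin N → Fin N → Set
      P x y = Adj G′ (σ′ x) (σ′ y)

      left : ∀ {i j} → Consecutive i j → P (old i) (old j)
      left {i} {j} i⋖j = subst₂ (Adj G′) (sym (extendʳ-↑ˡ (σ C) i)) (sym (extendʳ-↑ˡ (σ C) j))
        (trans (restrict (σ C i) (σ C j)) (adj-consecutive C i⋖j))

      boundary : ∀ {i j} → IsLast i → toℕ j ≡ 0 → P (old i) (suc n ↑ʳ j)
      boundary {i} {j} last j≡0 =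
        subst₂ (Adj G′) (sym (trans (extendʳ-↑ˡ (σ C) i) (cong old (ends-at-u₁ last)))) (sym (extendʳ-↑ʳ (σ C) j))
          (Adj-sym G′ (edge-first j j≡0))

      right : ∀ {i j} → Consecutive i j → P (suc n ↑ʳ i) (suc n ↑ʳ j)
      right {i} {j} i⋖j = subst₂ (Adj G′) (sym (extendʳ-↑ʳ (σ C) i)) (sym (extendʳ-↑ʳ (σ C) j))
        (Equivalence.from (cycle i j) (inj₁ (sym (next-consecutive i⋖j))))

      wrap : ∀ {i j} → IsLast i → toℕ j ≡ 0 → P (suc n ↑ʳ i) (old j)
      wrap {i} {j} last j≡0 =
        subst₂ (Adj G′) (sym (extendʳ-↑ʳ (σ C) i)) (sym (trans (extendʳ-↑ˡ (σ C) j) (cong old (starts-at-u₂ j≡0))))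
          (edge-last i (suc-injective last))

  insert-passes : ∀ C path {i j} → Consecutive i j → PassesThrough (insert C path) (suc n ↑ʳ i) (suc n ↑ʳ j)
  insert-passes C _ {i} {j} i⋖j = suc n ↑ʳ i , inj₁
    (extendʳ-↑ʳ (σ C) i , trans (cong (extendʳ (σ C)) (next-consecutive (consecutive-↑ʳ i⋖j))) (extendʳ-↑ʳ (σ C) j))

  contract : Adj G u₁ u₂ → HamCycle G′ → HamCycle G
  contract u₁~u₂ H = uncurry extract (align H) u₁~u₂

  expand : (C : HamCycle G) → PassesThrough C u₁ u₂ → HamCycle G′
  expand C p = uncurry insert (cut-at-edge C p)

  expand-passes : ∀ C p {i j} → Consecutive i j → PassesThrough (expand C p) (suc n ↑ʳ i) (suc n ↑ʳ j)
  expand-passes C p = uncurry insert-passes (cut-at-edge C p)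

  hamiltonian⇔ : Permissible G u₁ u₂ → Hamiltonian G′ ⇔ Hamiltonian G
  hamiltonian⇔ (u₁~u₂ , through) = mk⇔ (contract u₁~u₂) λ C → [ (λ ¬ham → ⊥-elim (¬ham C)) , uncurry expand ]′ through

  path-edge-permissible : Permissible G u₁ u₂ → ∀ i j → Consecutive i j → Permissible G′ (suc n ↑ʳ i) (suc n ↑ʳ j)
  path-edge-permissible (u₁~u₂ , through) i j i⋖j =
      Equivalence.from (cycle i j) (inj₁ (sym (next-consecutive i⋖j)))
    , [ (λ ¬ham → inj₁ (¬ham ∘ contract u₁~u₂)) , uncurry (λ C p → inj₂ (expand C p , expand-passes C p i⋖j)) ]′ through

open Attached using (hamiltonian⇔; path-edge-permissible)

lemma19 : ∀ {n k} (G : Graph n) (u₁ u₂ : Fin n) (G' : Graph (n + k)) →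
    Permissible G u₁ u₂ →
    AttachCycle G u₁ u₂ k G' →
    (Hamiltonian G' ⇔ Hamiltonian G) ×
    (∀ (i j : Fin k) → toℕ j ≡ suc (toℕ i) → Permissible G' (n ↑ʳ i) (n ↑ʳ j))
lemma19 {zero} G () u₂ G′ perm att
lemma19 {suc n} {zero} G u₁ u₂ G′ perm att with AttachCycle.k≥4 att
... | ()
lemma19 {suc n} {suc zero} G u₁ u₂ G′ perm att with AttachCycle.k≥4 att
... | s≤s ()
lemma19 {suc n} {suc (suc k)} G u₁ u₂ G′ perm att =
  hamiltonian⇔ att perm , path-edge-permissible att perm
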